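{- Let $n\geq1$, $\boldsymbol{\varepsilon}=(\varepsilon_1,\ldots,\varepsilon_n)\in\{\pm1\}^n$, and let $C(\boldsymbol{\varepsilon})_{i,j}\coloneqq\prod_{k=i}^j\varepsilon_k$ for $1\leq i\leq j\leq n$. For $i\leq j\leq n$ set $H(i,j)\coloneqq\sum_{u=i}^{j-1} C(\boldsymbol{\varepsilon})_{i,u}$ and $V(i,j)\coloneqq\sum_{v=i+1}^{j} C(\boldsymbol{\varepsilon})_{v,j}$. If $C(\boldsymbol{\varepsilon})_{i,j}=-1$, then $H(i,j) = -V(i,j)$. -}

module Defs where

open import Data.Nat using (ℕ; zero; suc; _+_; _<?_)
open import Data.Fin using (Fin; fromℕ<)
open import Data.Integer using (ℤ; +_; -[1+_]; _*_) renaming (_+_ to _+ℤ_)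
open import Data.Sign using (Sign)
open import Relation.Nullary using (yes; no)

signℤ : Sign → ℤ
signℤ Sign.+ = + 1
signℤ Sign.- = -[1+ 0 ]

-- 1-indexed access: ε k = ε_k for 1 ≤ k ≤ n  (entry Fin index k-1).
-- Outside that range it returns 1; it is only ever used inside the range.
eps : (n : ℕ) → (Fin n → Sign) → ℕ → ℤ
eps n ε zero = + 1
eps n ε (suc k) with k <? n
... | yes k<n = signℤ (ε (fromℕ< k<n))
... | no _    = + 1

prodFrom : (ℕ → ℤ) → ℕ → ℕ → ℤ
prodFrom f a zero      = + 1
prodFrom f a (suc len) = f a * prodFrom f (suc a) len

sumFrom : (ℕ → ℤ) → ℕ → ℕ → ℤ
sumFrom f a zero      = + 0
sumFrom f a (suc len) = f a +ℤ sumFrom f (suc a) len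

open import Data.Nat using (_∸_)

C : (n : ℕ) → (Fin n → Sign) → ℕ → ℕ → ℤ
C n ε i j = prodFrom (eps n ε) i (suc (j ∸ i))

H : (n : ℕ) → (Fin n → Sign) → ℕ → ℕ → ℤ
H n ε i j = sumFrom (λ u → C n ε i u) i (j ∸ i)

V : (n : ℕ) → (Fin n → Sign) → ℕ → ℕ → ℤ
V n ε i j = sumFrom (λ v → C n ε v j) (suc i) (j ∸ i)

-- Every C(ε)_{i,u} is ±1 and C_{i,u} · C_{u+1,j} = C_{i,j} = -1, so C_{i,u} = -C_{u+1,j}
-- for each i ≤ u < j. Summing over u, and reindexing v = u + 1, gives H(i,j) = -V(i,j).
{-# OPTIONS --safe #-}
module Submission where

open import Defs
open import Data.Nat using (ℕ; _≤_; _<_; _<?_; zero; suc; s≤s; _∸_) renaming (_+_ to _+ℕ_)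
open import Data.Nat.Properties
  using (≤-refl; <⇒≤; m≤n+m; +-suc; +-comm; +-∸-assoc; m∸n+n≡m)
open import Data.Fin using (Fin)
open import Data.Sign using (Sign) renaming (_*_ to _*ₛ_)
open import Data.Integer using (ℤ; -[1+_]; -_; _*_; _+_)
open import Data.Integer.Properties using (neg-distrib-+; *-identityˡ; *-assoc; -1*i≡-i)
open import Data.Product using (∃-syntax; _,_)
open import Relation.Nullary using (yes; no)
open import Relation.Binary.PropositionalEquality
open ≡-Reasoning

IsSign : ℤ → Set
IsSign x = ∃[ s ] signℤ s ≡ x

signℤ-* : ∀ s t → signℤ (s *ₛ t) ≡ signℤ s * signℤ t
signℤ-* Sign.+ Sign.+ = refl
signℤ-* Sign.+ Sign.- = refl
signℤ-* Sign.- Sign.+ = refl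
signℤ-* Sign.- Sign.- = refl

eps-isSign : ∀ n ε k → IsSign (eps n ε k)
eps-isSign n ε zero = Sign.+ , refl
eps-isSign n ε (suc k) with k <? n
... | yes k<n = ε _ , refl
... | no _    = Sign.+ , refl

prodFrom-isSign : ∀ {f} → (∀ k → IsSign (f k)) → ∀ a l → IsSign (prodFrom f a l)
prodFrom-isSign f-sign a zero = Sign.+ , refl
prodFrom-isSign f-sign a (suc l) with f-sign a | prodFrom-isSign f-sign (suc a) l
... | s , s≡fa | t , t≡prod = s *ₛ t , trans (signℤ-* s t) (cong₂ _*_ s≡fa t≡prod)

isSign-*≡-1 : ∀ {x y} → IsSign x → x * y ≡ -[1+ 0 ] → x ≡ - y
isSign-*≡-1 {y = y} (Sign.+ , refl) xy≡-1 = cong -_ (sym (trans (sym (*-identityˡ y)) xy≡-1))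
isSign-*≡-1 {y = y} (Sign.- , refl) xy≡-1 = sym (trans (sym (-1*i≡-i y)) xy≡-1)

prodFrom-+ : ∀ f a p q → prodFrom f a (p +ℕ q) ≡ prodFrom f a p * prodFrom f (p +ℕ a) q
prodFrom-+ f a zero q = sym (*-identityˡ _)
prodFrom-+ f a (suc p) q = begin
  f a * prodFrom f (suc a) (p +ℕ q)                        ≡⟨ cong (f a *_) (prodFrom-+ f (suc a) p q) ⟩
  f a * (prodFrom f (suc a) p * prodFrom f (p +ℕ suc a) q) ≡⟨ sym (*-assoc (f a) _ _) ⟩
  prodFrom f a (suc p) * prodFrom f (p +ℕ suc a) q         ≡⟨ cong (λ b → prodFrom f a (suc p) * prodFrom f b q) (+-suc p a) ⟩
  prodFrom f a (suc p) * prodFrom f (suc p +ℕ a) q         ∎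

∸-split : ∀ {i u j} → i ≤ u → u ≤ j → (u ∸ i) +ℕ (j ∸ u) ≡ j ∸ i
∸-split {i} {u} {j} i≤u u≤j = begin
  (u ∸ i) +ℕ (j ∸ u)  ≡⟨ +-comm (u ∸ i) (j ∸ u) ⟩
  (j ∸ u) +ℕ (u ∸ i)  ≡⟨ sym (+-∸-assoc (j ∸ u) i≤u) ⟩
  (j ∸ u) +ℕ u ∸ i    ≡⟨ cong (_∸ i) (m∸n+n≡m u≤j) ⟩
  j ∸ i               ∎

C-split : ∀ n ε {i u j} → i ≤ u → u < j → C n ε i u * C n ε (suc u) j ≡ C n ε i j
C-split n ε {i} {u} {j} i≤u u<j = begin
  prodFrom f i (suc (u ∸ i)) * prodFrom f (suc u) (suc (j ∸ suc u))
    ≡⟨ cong (λ l → prodFrom f i (suc (u ∸ i)) * prodFrom f (suc u) l) (sym (+-∸-assoc 1 u<j)) ⟩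
  prodFrom f i (suc (u ∸ i)) * prodFrom f (suc u) (j ∸ u)
    ≡⟨ cong (λ b → prodFrom f i (suc (u ∸ i)) * prodFrom f (suc b) (j ∸ u)) (sym (m∸n+n≡m i≤u)) ⟩
  prodFrom f i (suc (u ∸ i)) * prodFrom f (suc (u ∸ i) +ℕ i) (j ∸ u)
    ≡⟨ sym (prodFrom-+ f i (suc (u ∸ i)) (j ∸ u)) ⟩
  prodFrom f i (suc ((u ∸ i) +ℕ (j ∸ u)))
    ≡⟨ cong (λ l → prodFrom f i (suc l)) (∸-split i≤u (<⇒≤ u<j)) ⟩
  prodFrom f i (suc (j ∸ i)) ∎
  where f = eps n ε

sumFrom-neg-shift : ∀ g h a m → (∀ k → a ≤ k → k < m +ℕ a → g k ≡ - h (suc k)) →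
                    sumFrom g a m ≡ - sumFrom h (suc a) m
sumFrom-neg-shift g h a zero g≡-h = refl
sumFrom-neg-shift g h a (suc m) g≡-h = begin
  g a + sumFrom g (suc a) m
    ≡⟨ cong₂ _+_ (g≡-h a ≤-refl a<1+m+a) (sumFrom-neg-shift g h (suc a) m g≡-h′) ⟩
  - h (suc a) + - sumFrom h (suc (suc a)) m
    ≡⟨ sym (neg-distrib-+ (h (suc a)) _) ⟩
  - sumFrom h (suc a) (suc m) ∎
  where
  a<1+m+a : a < suc m +ℕ a
  a<1+m+a = s≤s (m≤n+m a m)
  g≡-h′ : ∀ k → suc a ≤ k → k < m +ℕ suc a → g k ≡ - h (suc k)
  g≡-h′ k 1+a≤k k<m+1+a = g≡-h k (<⇒≤ 1+a≤k) (subst (k <_) (+-suc m a) k<m+1+a)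

lemma5 : (n : ℕ) → 1 ≤ n → (ε : Fin n → Sign) → (i j : ℕ) →
    1 ≤ i → i ≤ j → j ≤ n →
    C n ε i j ≡ -[1+ 0 ] → H n ε i j ≡ - V n ε i j
lemma5 n _ ε i j _ i≤j _ Cij≡-1 = sumFrom-neg-shift _ _ i (j ∸ i) C-antisym
  where
  C-antisym : ∀ u → i ≤ u → u < (j ∸ i) +ℕ i → C n ε i u ≡ - C n ε (suc u) j
  C-antisym u i≤u u<j∸i+i = isSign-*≡-1 (prodFrom-isSign (eps-isSign n ε) i (suc (u ∸ i))) Ciu*Cu+1j≡-1
    where
    Ciu*Cu+1j≡-1 : C n ε i u * C n ε (suc u) j ≡ -[1+ 0 ]
    Ciu*Cu+1j≡-1 = trans (C-split n ε i≤u (subst (u <_) (m∸n+n≡m i≤j) u<j∸i+i)) Cij≡-1
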